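{- Let $G$ be a connected, non-complete, strictly chordal graph. Then $G$ is a strictly interval graph if and only if $D(CC(G))$ is a path.
   Context: All graphs are finite, simple and connected. For a vertex $v$, $N(v)$ is its set of neighbours and $N[v]=N(v)\cup\{v\}$. Two vertices $u,v$ are true twins if $N[u]=N[v]$. A vertex is simplicial if its neighbourhood is a clique. A graph is chordal if it has no induced cycle of length at least 4. A block graph is a connected graph in which every block (maximal 2-connected subgraph or bridge) is a clique. A graph is strictly chordal if it is obtained from a block graph by adding zero or more true twins to each vertex. An interval graph is the intersection graph of a family of intervals of the real line. A strictly interval graph is a graph that is both strictly chordal and interval. A critical clique of $G$ is a maximal set of vertices that are pairwise true twins (these sets partition $V(G)$). The critical clique graph $CC(G)$ is the graph whose vertices are the critical cliques of $G$, two critical cliques $Q_i,Q_j$ being adjacent iff some vertex of $Q_i$ is adjacent in $G$ to some vertex of $Q_j$. For a chordal graph $X$, the derived graph $D(X)$ is the induced subgraph of $X$ obtained by deleting all simplicial vertices of $X$. -}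

module Defs where

open import Data.Nat using (ℕ; zero; suc; _≤_; _∸_)
open import Data.Bool using (Bool; true; false)
open import Data.Fin using (Fin; toℕ)
open import Data.Fin.Subset using (Subset; _∈_; _⊆_; _-_; ⊤)
open import Data.Product using (Σ; ∃; ∃-syntax; _×_; _,_)
open import Data.Sum using (_⊎_)
open import Relation.Nullary using (¬_)
open import Relation.Binary.PropositionalEquality using (_≡_; _≢_)
open import Function.Bundles using (_⇔_)
open import Function.Definitions using (Injective)

record Graph (n : ℕ) : Set where
  field
    E      : Fin n → Fin n → Bool
    sym    : ∀ u v → E u v ≡ E v u
    irrefl : ∀ v → E v v ≡ false

module _ {n : ℕ} (G : Graph n) where
  open Graph G

  Adj : Fin n → Fin n → Set
  Adj u v = E u v ≡ true

  data WalkIn (S : Subset n) : Fin n → Fin n → Set where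
    here : ∀ {u} → u ∈ S → WalkIn S u u
    step : ∀ {u w v} → u ∈ S → Adj u w → WalkIn S w v → WalkIn S u v

  ConnectedIn : Subset n → Set
  ConnectedIn S = ∀ u v → u ∈ S → v ∈ S → WalkIn S u v

  Connected : Set
  Connected = Fin n × ConnectedIn ⊤

  Complete : Set
  Complete = ∀ u v → u ≢ v → Adj u v

  IsClique : Subset n → Set
  IsClique S = ∀ u v → u ∈ S → v ∈ S → u ≢ v → Adj u v

  Simplicial : Fin n → Set
  Simplicial v = ∀ x y → Adj v x → Adj v y → x ≢ y → Adj x y

  InN[_] : Fin n → Fin n → Set
  InN[ u ] w = w ≡ u ⊎ Adj u w

  TrueTwins : Fin n → Fin n → Set
  TrueTwins u v = ∀ w → InN[ u ] w ⇔ InN[ v ] w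

  CycAdj : (k : ℕ) → Fin k → Fin k → Set
  CycAdj k i j = (suc (toℕ i) ≡ toℕ j) ⊎ (suc (toℕ j) ≡ toℕ i)
               ⊎ (toℕ i ≡ k ∸ 1 × toℕ j ≡ 0) ⊎ (toℕ j ≡ k ∸ 1 × toℕ i ≡ 0)

  IsInducedCycle : (k : ℕ) → (Fin k → Fin n) → Set
  IsInducedCycle k c = Injective _≡_ _≡_ c × (∀ i j → Adj (c i) (c j) ⇔ CycAdj k i j)

  Chordal : Set
  Chordal = ∀ k → 4 ≤ k → (c : Fin k → Fin n) → ¬ IsInducedCycle k c

  -- G[S] is nonempty, connected and has no cut vertex
  -- (a single vertex, or a bridge, or a 2-connected induced subgraph)
  NoCutVertex : Subset n → Set
  NoCutVertex S = (∃[ v ] v ∈ S) × ConnectedIn S × (∀ v → v ∈ S → ConnectedIn (S - v))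

  IsBlock : Subset n → Set
  IsBlock S = NoCutVertex S × (∀ T → S ⊆ T → NoCutVertex T → T ⊆ S)

  BlockGraph : Set
  BlockGraph = Connected × (∀ S → IsBlock S → IsClique S)

-- Strictly chordal: G is obtained (up to isomorphism) from a block graph H
-- by adding true twins: each vertex x of H is replaced by the nonempty
-- clique f⁻¹(x), all of whose members keep the (closed) neighbourhood of x.

StrictlyChordal : ∀ {n} → Graph n → Set
StrictlyChordal {n} G =
  ∃[ m ] Σ (Graph m) λ H → BlockGraph H × Σ (Fin n → Fin m) λ f →
    (∀ x → ∃[ u ] f u ≡ x) ×
    (∀ u v → u ≢ v → Adj G u v ⇔ (f u ≡ f v ⊎ Adj H (f u) (f v)))

Interval : ∀ {n} → Graph n → Set
Interval {n} G =
  Σ (Fin n → ℕ) λ a → Σ (Fin n → ℕ) λ b →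
    (∀ v → a v ≤ b v) ×
    (∀ u v → u ≢ v → Adj G u v ⇔ (a u ≤ b v × a v ≤ b u))

StrictlyInterval : ∀ {n} → Graph n → Set
StrictlyInterval G = StrictlyChordal G × Interval G

-- H (on Fin m) together with q : Fin n → Fin m
-- presents CC(G): q is surjective, its fibres are exactly the classes of
-- the true-twin relation (the critical cliques), and distinct classes are
-- adjacent in H iff some member of one is adjacent in G to some member of
-- the other.

IsCriticalCliqueGraph : ∀ {n m} → Graph n → Graph m → (Fin n → Fin m) → Set
IsCriticalCliqueGraph {n} {m} G H q =
  (∀ i → ∃[ u ] q u ≡ i) ×
  (∀ u v → q u ≡ q v ⇔ TrueTwins G u v) ×
  (∀ i j → Adj H i j ⇔ (i ≢ j × ∃[ u ] ∃[ v ] (q u ≡ i × q v ≡ j × Adj G u v)))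

-- D(X) is a path: the non-simplicial vertices of X can be listed without
-- repetition as w₀, …, w_{k-1} (k ≥ 1) so that the subgraph of X induced
-- on them has exactly the edges w_i w_{i+1}.

DerivedIsPath : ∀ {m} → Graph m → Set
DerivedIsPath {m} X =
  ∃[ k ] 1 ≤ k × Σ (Fin k → Fin m) λ w →
    Injective _≡_ _≡_ w ×
    (∀ i → ¬ Simplicial X (w i)) ×
    (∀ x → ¬ Simplicial X x → ∃[ i ] w i ≡ x) ×
    (∀ i j → Adj X (w i) (w j) ⇔ (suc (toℕ i) ≡ toℕ j ⊎ suc (toℕ j) ≡ toℕ i))

-- The theorem is really about the twin-free graph H = CC(G). G is a blow-up of H, so an interval
-- model of either graph restricts or lifts to the other; and H embeds as an induced subgraph of the
-- block graph underlying G, so the common neighbours of any edge of H are adjacent (H has no induced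
-- diamond). In an interval model of such an H no non-simplicial vertex has its interval nested in
-- another's, so ordering the non-simplicial vertices by left endpoint, two of them are adjacent
-- exactly when they are successive: an edge skipping a vertex would make the skipped vertex
-- simplicial, and the gap after a vertex would be crossed by a simplicial vertex with two
-- non-adjacent neighbours. Conversely, given the path w₀ … w_{k-1} of non-simplicial vertices, let wᵢ
-- span the slots 2i … 2i+2. In the connected twin-free H every simplicial vertex is adjacent to one
-- path vertex wᵢ or to two consecutive ones wᵢ, wᵢ₊₁, and becomes a point in slot 2i+1 or 2i+2.

module Submission where

open import Defs
open import Data.Bool using (true)
import Data.Bool as Bool
open import Data.Empty using (⊥; ⊥-elim)
open import Data.Fin as Fin using (Fin; toℕ; fromℕ<; _≟_)
open import Data.Fin.Properties using (all?; any?; ¬∀⟶∃¬; toℕ-injective; toℕ<n; toℕ-fromℕ<)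
open import Data.Fin.Subset using (Subset; _∈_; _⊆_; _-_; _⊃_; ⊤)
open import Data.Fin.Subset.Properties using (∈⊤; _∈?_; x∈p∧x≢y⇒x∈p-y; p─q⊆p)
open import Data.Fin.Subset.Induction using (⊃-wellFounded; Acc; acc)
open import Data.List using (List; _∷_; lookup; filter; allFin; length)
import Data.List.Membership.Propositional as Mem
open import Data.List.Membership.Propositional.Properties using (∈-lookup; ∈-filter⁻; ∈-filter⁺; ∈-allFin)
open import Data.List.Relation.Binary.Permutation.Propositional using (↭-sym; ↭⇒↭ₛ)
open import Data.List.Relation.Binary.Permutation.Propositional.Properties using (∈-resp-↭)
import Data.List.Relation.Binary.Permutation.Setoid.Properties as Perm
import Data.List.Relation.Unary.All as All
import Data.List.Relation.Unary.Any as Any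
open import Data.List.Relation.Unary.Any.Properties using (lookup-index)
open import Data.List.Relation.Unary.AllPairs using (_∷_)
open import Data.List.Relation.Unary.Sorted.TotalOrder.Properties using (lookup-mono-≤)
open import Data.List.Relation.Unary.Unique.Propositional using (Unique)
open import Data.List.Relation.Unary.Unique.Propositional.Properties using (filter⁺; allFin⁺)
import Data.List.Sort as Sort
open import Data.Nat using (ℕ; suc; _+_; _*_; _≤_; _<_; z≤n; s≤s; _≤?_) renaming (_≟_ to _≟ℕ_)
open import Data.Nat.Properties
  using (*-cancelˡ-<; *-cancelˡ-≤; *-monoʳ-≤; *-monoˡ-≤; *-suc; +-cancelˡ-≡; +-comm; +-mono-≤;
         +-monoʳ-<; <-asym; <-cmp; <-irrefl; <-trans; <-≤-trans; <⇒≢; <⇒≤; <⇒≱; m<n⇒m<1+n;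
         m≤m+n; m≤n⇒m<n∨m≡n; m≤n⇒m≤1+n; n<1+n; n≤1+n; ≤-<-trans; ≤-antisym; ≤-decTotalOrder;
         ≤-pred; ≤-refl; ≤-reflexive; ≤-total; ≤-trans; ≤∧≢⇒<; ≮⇒≥; ≰⇒>; module ≤-Reasoning)
open import Data.Product using (∃; ∃₂; ∃-syntax; _×_; _,_; proj₁; proj₂; swap)
open import Data.Product.Function.NonDependent.Propositional using (_×-⇔_)
open import Data.Sum using (_⊎_; inj₁; inj₂; map₁)
open import Data.Vec using (tabulate)
open import Data.Vec.Properties using (lookup∘tabulate; []=⇒lookup; lookup⇒[]=)
open import Function using (_∘_; case_of_)
open import Function.Bundles using (_⇔_; mk⇔; Equivalence)
open import Function.Definitions using (Injective)
import Function.Properties.Equivalence as ⇔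
open import Relation.Binary.Bundles using (DecTotalOrder)
import Relation.Binary.Construct.On as On
open import Relation.Binary.Definitions using (tri<; tri≈; tri>)
open import Relation.Binary.PropositionalEquality
  using (_≡_; _≢_; refl; sym; trans; cong; subst; subst₂; setoid; ≢-sym)
open import Relation.Nullary using (¬_; Dec; yes; no; does; contradiction; ¬?)
open import Relation.Nullary.Decidable using (_×-dec_; _⊎-dec_; _→-dec_; dec-true; decidable-stable)
open import Relation.Unary using (Pred; Decidable)

open Equivalence using (to; from)

Consecutive : ℕ → ℕ → Set
Consecutive i j = suc i ≡ j ⊎ suc j ≡ i

consecutive⇔ : ∀ {i j} → i ≢ j → (i ≤ suc j × j ≤ suc i) ⇔ Consecutive i j
consecutive⇔ {i} {j} i≢j = mk⇔ close far
  where
  close : i ≤ suc j × j ≤ suc i → Consecutive i j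
  close (i≤j+1 , j≤i+1) with <-cmp i j
  ... | tri< i<j _ _ = inj₁ (≤-antisym i<j j≤i+1)
  ... | tri≈ _ i≡j _ = contradiction i≡j i≢j
  ... | tri> _ _ j<i = inj₂ (≤-antisym j<i i≤j+1)
  far : Consecutive i j → i ≤ suc j × j ≤ suc i
  far (inj₁ refl) = m≤n⇒m≤1+n (n≤1+n i) , ≤-refl
  far (inj₂ refl) = ≤-refl , m≤n⇒m≤1+n (n≤1+n j)

*+-≤⇒≤ : ∀ {M p q r s} → s < M → p * M + r ≤ q * M + s → p ≤ q
*+-≤⇒≤ {M} {p} {q} {r} {s} s<M le = ≮⇒≥ λ q<p → <⇒≱ (begin-strict
  q * M + s  <⟨ +-monoʳ-< (q * M) s<M ⟩
  q * M + M  ≡⟨ +-comm (q * M) M ⟩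
  suc q * M  ≤⟨ *-monoˡ-≤ M q<p ⟩
  p * M      ≤⟨ m≤m+n (p * M) r ⟩
  p * M + r  ∎) le
  where open ≤-Reasoning

*+-≤⇔ : ∀ {M p q r s} → r ≤ s → s < M → (p * M + r ≤ q * M + s ⇔ p ≤ q)
*+-≤⇔ {M} r≤s s<M = mk⇔ (*+-≤⇒≤ s<M) λ p≤q → +-mono-≤ (*-monoˡ-≤ M p≤q) r≤s

*+-injectiveʳ : ∀ {M p q r s} → r < M → s < M → p * M + r ≡ q * M + s → r ≡ s
*+-injectiveʳ {M} {p} {q} r<M s<M e
  with refl ← ≤-antisym (*+-≤⇒≤ {M} {p} {q} s<M (≤-reflexive e))
                        (*+-≤⇒≤ {M} {q} {p} r<M (≤-reflexive (sym e)))
  = +-cancelˡ-≡ (p * M) _ _ e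

leastWitness : ∀ {k p} {P : Pred (Fin k) p} → Decidable P → ∃ P →
               ∃[ i ] P i × (∀ j → P j → toℕ i ≤ toℕ j)
leastWitness {suc k} P? (i , pi) with P? Fin.zero | i
... | yes p0 | _ = Fin.zero , p0 , λ _ _ → z≤n
... | no ¬p0 | Fin.zero = contradiction pi ¬p0
... | no ¬p0 | Fin.suc i′ =
  let l , pl , l-least = leastWitness (P? ∘ Fin.suc) (i′ , pi)
  in Fin.suc l , pl , λ { Fin.zero p0 → contradiction p0 ¬p0 ; (Fin.suc j) pj → s≤s (l-least j pj) }

Unique-lookup-injective : ∀ {A : Set} {xs : List A} → Unique xs → Injective _≡_ _≡_ (lookup xs)
Unique-lookup-injective {xs = _ ∷ _} (_ ∷ _) {Fin.zero} {Fin.zero} _ = refl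
Unique-lookup-injective {xs = _ ∷ _} (x∉xs ∷ _) {Fin.zero} {Fin.suc j} e =
  contradiction e (All.lookup x∉xs (∈-lookup j))
Unique-lookup-injective {xs = _ ∷ _} (x∉xs ∷ _) {Fin.suc i} {Fin.zero} e =
  contradiction (sym e) (All.lookup x∉xs (∈-lookup i))
Unique-lookup-injective {xs = _ ∷ _} (_ ∷ u) {Fin.suc i} {Fin.suc j} e = cong Fin.suc (Unique-lookup-injective u e)

record IncreasingEnumeration {n p} (P : Pred (Fin n) p) (key : Fin n → ℕ) : Set p where
  field
    size           : ℕ
    elem           : Fin size → Fin n
    elem∈P         : ∀ i → P (elem i)
    elem-onto      : ∀ x → P x → ∃[ i ] elem i ≡ x
    key-strictMono : ∀ {i j} → toℕ i < toℕ j → key (elem i) < key (elem j)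

  key-reflects-< : ∀ {i j} → key (elem i) < key (elem j) → toℕ i < toℕ j
  key-reflects-< {i} {j} lt with <-cmp (toℕ i) (toℕ j)
  ... | tri< i<j _ _ = i<j
  ... | tri≈ _ i≡j _ with refl ← toℕ-injective i≡j = contradiction lt (<-irrefl refl)
  ... | tri> _ _ j<i = contradiction (key-strictMono j<i) (<-asym lt)

  elem-injective : Injective _≡_ _≡_ elem
  elem-injective {i} {j} e with <-cmp (toℕ i) (toℕ j)
  ... | tri< i<j _ _ = contradiction (cong key e) (<⇒≢ (key-strictMono i<j))
  ... | tri≈ _ i≡j _ = toℕ-injective i≡j
  ... | tri> _ _ j<i = contradiction (cong key (sym e)) (<⇒≢ (key-strictMono j<i))

increasingEnumeration : ∀ {n p} {P : Pred (Fin n) p} (P? : Decidable P) {key : Fin n → ℕ} →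
  (∀ {x y} → P x → P y → key x ≡ key y → x ≡ y) → IncreasingEnumeration P key
increasingEnumeration {n} {P = P} P? {key} key-injective = record
  { size = length sorted ; elem = lookup sorted ; elem∈P = ∈P ; elem-onto = onto
  ; key-strictMono = strictMono }
  where
  O : DecTotalOrder _ _ _
  O = On.decTotalOrder ≤-decTotalOrder key
  open Sort O using (sort; sort-↭; sort-↗)
  candidates sorted : List (Fin n)
  candidates = filter P? (allFin n)
  sorted = sort candidates
  ∈P : ∀ i → P (lookup sorted i)
  ∈P i = proj₂ (∈-filter⁻ P? {xs = allFin n} (∈-resp-↭ (sort-↭ candidates) (∈-lookup i)))
  onto : ∀ x → P x → ∃[ i ] lookup sorted i ≡ x
  onto x px = Any.index x∈ , sym (lookup-index x∈)
    where
    x∈ : x Mem.∈ sorted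
    x∈ = ∈-resp-↭ (↭-sym (sort-↭ candidates)) (∈-filter⁺ P? (∈-allFin x) px)
  unique : Unique sorted
  unique = Perm.Unique-resp-↭ (setoid (Fin n)) (↭⇒↭ₛ (↭-sym (sort-↭ candidates)))
                              (filter⁺ P? (allFin⁺ n))
  strictMono : ∀ {i j} → toℕ i < toℕ j → key (lookup sorted i) < key (lookup sorted j)
  strictMono {i} {j} i<j =
    ≤∧≢⇒< (lookup-mono-≤ (DecTotalOrder.totalOrder O) (sort-↗ candidates) (<⇒≤ i<j)) λ e →
      <⇒≢ i<j (cong toℕ (Unique-lookup-injective unique (key-injective (∈P i) (∈P j) e)))

subsetOf : ∀ {n p} {P : Pred (Fin n) p} → Decidable P → Subset n
subsetOf P? = tabulate (does ∘ P?)

module _ {n p} {P : Pred (Fin n) p} (P? : Decidable P) where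

  ∈-subsetOf⁺ : ∀ {x} → P x → x ∈ subsetOf P?
  ∈-subsetOf⁺ {x} px =
    lookup⇒[]= x (subsetOf P?) (trans (lookup∘tabulate (does ∘ P?) x) (dec-true (P? x) px))

  ∈-subsetOf⁻ : ∀ {x} → x ∈ subsetOf P? → P x
  ∈-subsetOf⁻ {x} x∈ with P? x | trans (sym (lookup∘tabulate (does ∘ P?) x)) ([]=⇒lookup x∈)
  ... | yes px | _ = px
  ... | no _ | ()

-- Twins, simplicial vertices, walks and blocks

module _ {n : ℕ} (X : Graph n) where

  Adj-sym : ∀ {u v} → Adj X u v → Adj X v u
  Adj-sym {u} {v} = trans (Graph.sym X v u)

  Adj-irrefl : ∀ {u} → ¬ Adj X u u
  Adj-irrefl {u} e = contradiction (trans (sym (Graph.irrefl X u)) e) λ ()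

  Adj⇒≢ : ∀ {u v} → Adj X u v → u ≢ v
  Adj⇒≢ e refl = Adj-irrefl e

  Adj? : ∀ u v → Dec (Adj X u v)
  Adj? u v = Graph.E X u v Bool.≟ true

  InN? : ∀ u w → Dec (InN[_] X u w)
  InN? u w = (w ≟ u) ⊎-dec Adj? u w

  InN-sym : ∀ {u w} → InN[_] X u w → InN[_] X w u
  InN-sym (inj₁ refl) = inj₁ refl
  InN-sym (inj₂ e) = inj₂ (Adj-sym e)

  Simplicial? : ∀ v → Dec (Simplicial X v)
  Simplicial? v = all? λ x → all? λ y → Adj? v x →-dec Adj? v y →-dec ¬? (x ≟ y) →-dec Adj? x y

  ¬Complete⇒nonadjacentPair : ¬ Complete X → ∃₂ λ u v → u ≢ v × ¬ Adj X u v
  ¬Complete⇒nonadjacentPair ¬complete =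
    let u , ¬∀v = ¬∀⟶∃¬ n _ (λ u → all? (edge? u)) ¬complete
        v , ¬e  = ¬∀⟶∃¬ n _ (edge? u) ¬∀v
    in u , v , (λ u≡v → ¬e λ u≢v → contradiction u≡v u≢v) , (λ e → ¬e λ _ → e)
    where
    edge? : ∀ u v → Dec (u ≢ v → Adj X u v)
    edge? u v = ¬? (u ≟ v) →-dec Adj? u v

  TwinFree : Set
  TwinFree = ∀ u v → TrueTwins X u v → u ≡ v

  twins⇒Adj : ∀ {u v} → TrueTwins X u v → u ≢ v → Adj X u v
  twins⇒Adj {u} {v} twins u≢v with from (twins v) (inj₁ refl)
  ... | inj₁ v≡u = contradiction (sym v≡u) u≢v
  ... | inj₂ e = e

  twins-respect-Adj : ∀ {u u′ v v′} → TrueTwins X u u′ → TrueTwins X v v′ → u ≢ v →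
                      Adj X u′ v′ → Adj X u v
  twins-respect-Adj {u} {v′ = v′} uu′ vv′ u≢v e
    with from (vv′ u) (InN-sym (from (uu′ v′) (inj₂ e)))
  ... | inj₁ u≡v = contradiction u≡v u≢v
  ... | inj₂ vu = Adj-sym vu

  simplicial-Adj⇒twins : ∀ {u v} → Simplicial X u → Simplicial X v → Adj X u v → TrueTwins X u v
  simplicial-Adj⇒twins su sv uv w = mk⇔ (closedNbhd⊆ su uv) (closedNbhd⊆ sv (Adj-sym uv))
    where
    closedNbhd⊆ : ∀ {u v} → Simplicial X u → Adj X u v → InN[_] X u w → InN[_] X v w
    closedNbhd⊆ _ uv (inj₁ refl) = inj₂ (Adj-sym uv)
    closedNbhd⊆ {v = v} su uv (inj₂ uw) with w ≟ v
    ... | yes w≡v = inj₁ w≡v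
    ... | no w≢v = inj₂ (su v w uv uw (≢-sym w≢v))

  simplicial-nonadjacent : TwinFree → ∀ {u v} → Simplicial X u → Simplicial X v → ¬ Adj X u v
  simplicial-nonadjacent twinFree su sv uv with refl ← twinFree _ _ (simplicial-Adj⇒twins su sv uv) =
    Adj-irrefl uv

  walk-crossing : ∀ {S u v} (g : Fin n → ℕ) {c} → WalkIn X S u v → g u ≤ c → c < g v →
                  ∃₂ λ x z → Adj X x z × g x ≤ c × c < g z
  walk-crossing g (here _) gu≤c c<gu = contradiction gu≤c (<⇒≱ c<gu)
  walk-crossing {u = u} g {c} (step {w = w} _ uw rest) gu≤c c<gv with g w ≤? c
  ... | yes gw≤c = walk-crossing g rest gw≤c c<gv
  ... | no gw≰c = u , w , uw , gu≤c , ≰⇒> gw≰c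

  walk⇒neighbour : ∀ {S u v} → WalkIn X S u v → u ≢ v → ∃ (Adj X u)
  walk⇒neighbour (here _) u≢u = contradiction refl u≢u
  walk⇒neighbour (step _ uw _) _ = _ , uw

  ∃¬Simplicial : TwinFree → Connected X → ∀ {u v} → u ≢ v → ∃[ x ] ¬ Simplicial X x
  ∃¬Simplicial twinFree (_ , conn) {u} {v} u≢v = ¬∀⟶∃¬ n _ Simplicial? λ allSimplicial →
    let z , uz = walk⇒neighbour (conn u v ∈⊤ ∈⊤) u≢v
    in simplicial-nonadjacent twinFree (allSimplicial u) (allSimplicial z) uz

  DiamondFree : Set
  DiamondFree = ∀ {p q x y} → Adj X p q → Adj X p x → Adj X p y → Adj X q x → Adj X q y →
                x ≢ y → Adj X x y

  dominated⇒Simplicial : DiamondFree → ∀ {v u} → Adj X v u → (∀ {t} → Adj X v t → InN[_] X u t) →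
                         Simplicial X v
  dominated⇒Simplicial diamondFree vu dominated x y vx vy x≢y with dominated vx | dominated vy
  ... | inj₁ refl | inj₁ refl = contradiction refl x≢y
  ... | inj₁ refl | inj₂ uy = uy
  ... | inj₂ ux | inj₁ refl = Adj-sym ux
  ... | inj₂ ux | inj₂ uy = diamondFree vu vx vy ux uy x≢y

  star⇒ConnectedIn : ∀ {S c} → c ∈ S → (∀ {z} → z ∈ S → InN[_] X c z) → ConnectedIn X S
  star⇒ConnectedIn {S} {c} c∈S dominated u v u∈S v∈S = toCentre u∈S (fromCentre v∈S)
    where
    fromCentre : ∀ {v} → v ∈ S → WalkIn X S c v
    fromCentre v∈S with dominated v∈S
    ... | inj₁ refl = here c∈S
    ... | inj₂ cv = step c∈S cv (here v∈S)
    toCentre : ∀ {u} → u ∈ S → WalkIn X S c v → WalkIn X S u v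
    toCentre u∈S walk with dominated u∈S
    ... | inj₁ refl = walk
    ... | inj₂ cu = step u∈S (Adj-sym cu) walk

  twoCentres⇒NoCutVertex : ∀ {S p q} → p ∈ S → q ∈ S → p ≢ q →
    (∀ {z} → z ∈ S → InN[_] X p z × InN[_] X q z) → NoCutVertex X S
  twoCentres⇒NoCutVertex {S} {p} {q} p∈S q∈S p≢q dominated =
    (p , p∈S) , star⇒ConnectedIn p∈S (proj₁ ∘ dominated) , remove
    where
    remove : ∀ v → v ∈ S → ConnectedIn X (S - v)
    remove v _ with v ≟ p
    ... | yes refl = star⇒ConnectedIn (x∈p∧x≢y⇒x∈p-y q∈S (≢-sym p≢q))
                                      (proj₂ ∘ dominated ∘ p─q⊆p S _)
    ... | no v≢p   = star⇒ConnectedIn (x∈p∧x≢y⇒x∈p-y p∈S (≢-sym v≢p))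
                                      (proj₁ ∘ dominated ∘ p─q⊆p S _)

  -- Only ¬¬, as NoCutVertex is not decided here; enough, since adjacency is decidable.
  NoCutVertex⇒¬¬⊆Block : ∀ {S} → NoCutVertex X S → ¬ ¬ (∃[ B ] S ⊆ B × IsBlock X B)
  NoCutVertex⇒¬¬⊆Block {S} noCut = grow (⊃-wellFounded S) noCut (λ z∈S → z∈S)
    where
    grow : ∀ {T} → Acc _⊃_ T → NoCutVertex X T → S ⊆ T → ¬ ¬ (∃[ B ] S ⊆ B × IsBlock X B)
    grow {T} (acc larger) noCutT S⊆T noBlock = noBlock (T , S⊆T , noCutT , maximal)
      where
      maximal : ∀ T′ → T ⊆ T′ → NoCutVertex X T′ → T′ ⊆ T
      maximal T′ T⊆T′ noCutT′ {z} z∈T′ with z ∈? T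
      ... | yes z∈T = z∈T
      ... | no z∉T =
        ⊥-elim (grow (larger (T⊆T′ , z , z∈T′ , z∉T)) noCutT′ (λ z∈S → T⊆T′ (S⊆T z∈S)) noBlock)

  blockGraph⇒DiamondFree : BlockGraph X → DiamondFree
  blockGraph⇒DiamondFree (_ , blocksAreCliques) {p} {q} {x} {y} pq px py qx qy x≢y =
    decidable-stable (Adj? x y) λ ¬xy → NoCutVertex⇒¬¬⊆Block noCut λ (B , S⊆B , block) →
      ¬xy (blocksAreCliques B block x y (S⊆B (∈S (inj₂ px) (inj₂ qx))) (S⊆B (∈S (inj₂ py) (inj₂ qy)))
                            x≢y)
    where
    common? : ∀ z → Dec (InN[_] X p z × InN[_] X q z)
    common? z = InN? p z ×-dec InN? q z
    S : Subset n
    S = subsetOf common?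
    ∈S : ∀ {z} → InN[_] X p z → InN[_] X q z → z ∈ S
    ∈S pz qz = ∈-subsetOf⁺ common? (pz , qz)
    noCut : NoCutVertex X S
    noCut = twoCentres⇒NoCutVertex (∈S (inj₁ refl) (inj₂ (Adj-sym pq))) (∈S (inj₂ pq) (inj₁ refl))
                                   (Adj⇒≢ pq) (∈-subsetOf⁻ common?)

-- Induced subgraphs, blow-ups and the critical clique graph

record InducedEmbedding {m n} (H : Graph m) (K : Graph n) (g : Fin m → Fin n) : Set where
  field
    injective : Injective _≡_ _≡_ g
    Adj⇔      : ∀ {i j} → i ≢ j → Adj H i j ⇔ Adj K (g i) (g j)

module _ {m n} {H : Graph m} {K : Graph n} {g : Fin m → Fin n} (embedding : InducedEmbedding H K g) where
  open InducedEmbedding embedding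

  interval-restrict : Interval K → Interval H
  interval-restrict (a , b , a≤b , Adj⇔overlap) =
    a ∘ g , b ∘ g , a≤b ∘ g ,
    λ i j i≢j → ⇔.trans (Adj⇔ i≢j) (Adj⇔overlap (g i) (g j) (i≢j ∘ injective))

  diamondFree-restrict : DiamondFree K → DiamondFree H
  diamondFree-restrict diamondFree pq px py qx qy x≢y =
    from (Adj⇔ x≢y) (diamondFree (↑ pq) (↑ px) (↑ py) (↑ qx) (↑ qy) (x≢y ∘ injective))
    where
    ↑ : ∀ {i j} → Adj H i j → Adj K (g i) (g j)
    ↑ e = to (Adj⇔ (Adj⇒≢ H e)) e

-- StrictlyChordal G unfolds to: G is a blow-up of a block graph.
record IsBlowUp {n m} (G : Graph n) (H : Graph m) (f : Fin n → Fin m) : Set where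
  field
    surjective : ∀ x → ∃[ u ] f u ≡ x
    Adj⇔       : ∀ {u v} → u ≢ v → Adj G u v ⇔ (f u ≡ f v ⊎ Adj H (f u) (f v))

module BlowUp {n m} {G : Graph n} {H : Graph m} {f : Fin n → Fin m} (blowUp : IsBlowUp G H f) where
  open IsBlowUp blowUp

  section : Fin m → Fin n
  section x = proj₁ (surjective x)

  f∘section : ∀ x → f (section x) ≡ x
  f∘section x = proj₂ (surjective x)

  Adj-project : ∀ {u v} → Adj G u v → f u ≡ f v ⊎ Adj H (f u) (f v)
  Adj-project e = to (Adj⇔ (Adj⇒≢ G e)) e

  Adj⇔-separated : ∀ {u v} → f u ≢ f v → Adj G u v ⇔ Adj H (f u) (f v)
  Adj⇔-separated fu≢fv = mk⇔
    (λ e → case Adj-project e of λ { (inj₁ fu≡fv) → contradiction fu≡fv fu≢fv ; (inj₂ e′) → e′ })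
    (λ e → from (Adj⇔ (fu≢fv ∘ cong f)) (inj₂ e))

  closedNbhd⇔ : ∀ u w → InN[_] G u w ⇔ InN[_] H (f u) (f w)
  closedNbhd⇔ u w = mk⇔ project lift
    where
    project : InN[_] G u w → InN[_] H (f u) (f w)
    project (inj₁ refl) = inj₁ refl
    project (inj₂ uw) = map₁ sym (Adj-project uw)
    lift : InN[_] H (f u) (f w) → InN[_] G u w
    lift fw∈N[fu] with w ≟ u
    ... | yes w≡u = inj₁ w≡u
    ... | no w≢u = inj₂ (from (Adj⇔ (≢-sym w≢u)) (map₁ sym fw∈N[fu]))

  twins-lift : ∀ {u v} → TrueTwins H (f u) (f v) → TrueTwins G u v
  twins-lift {u} {v} twins w = ⇔.trans (closedNbhd⇔ u w) (⇔.trans (twins (f w)) (⇔.sym (closedNbhd⇔ v w)))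

  fibre-twins : ∀ {u v} → f u ≡ f v → TrueTwins G u v
  fibre-twins {u} fu≡fv = twins-lift (subst (TrueTwins H (f u)) fu≡fv λ _ → ⇔.refl)

  walk-project : ∀ {u v} → WalkIn G ⊤ u v → WalkIn H ⊤ (f u) (f v)
  walk-project (here _) = here ∈⊤
  walk-project {v = v} (step _ uw rest) with Adj-project uw
  ... | inj₁ fu≡fw = subst (λ x → WalkIn H ⊤ x (f v)) (sym fu≡fw) (walk-project rest)
  ... | inj₂ fufw = step ∈⊤ fufw (walk-project rest)

  connected : Connected G → Connected H
  connected (u₀ , conn) = f u₀ , λ x y _ _ →
    subst₂ (WalkIn H ⊤) (f∘section x) (f∘section y) (walk-project (conn (section x) (section y) ∈⊤ ∈⊤))

  interval-lift : Interval H → Interval G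
  interval-lift (a , b , a≤b , Adj⇔overlap) = a ∘ f , b ∘ f , a≤b ∘ f , Adj⇔overlap′
    where
    Adj⇔overlap′ : ∀ u v → u ≢ v → Adj G u v ⇔ (a (f u) ≤ b (f v) × a (f v) ≤ b (f u))
    Adj⇔overlap′ u v u≢v with f u ≟ f v
    ... | no fu≢fv = ⇔.trans (Adj⇔-separated fu≢fv) (Adj⇔overlap (f u) (f v) fu≢fv)
    ... | yes fu≡fv rewrite fu≡fv =
      mk⇔ (λ _ → a≤b (f v) , a≤b (f v)) (λ _ → from (Adj⇔ u≢v) (inj₁ fu≡fv))

  f∘section-injective : Injective _≡_ _≡_ (f ∘ section)
  f∘section-injective {x} {y} e = trans (sym (f∘section x)) (trans e (f∘section y))

  section-embedding : InducedEmbedding H G section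
  section-embedding = record { injective = f∘section-injective ∘ cong f ; Adj⇔ = Adj⇔-section }
    where
    Adj⇔-section : ∀ {x y} → x ≢ y → Adj H x y ⇔ Adj G (section x) (section y)
    Adj⇔-section {x} {y} x≢y =
      subst₂ (λ x′ y′ → Adj H x′ y′ ⇔ Adj G (section x) (section y)) (f∘section x) (f∘section y)
             (⇔.sym (Adj⇔-separated (x≢y ∘ f∘section-injective)))

  embedding-through : ∀ {k} {F : Graph k} {e : Fin k → Fin n} →
    InducedEmbedding F G e → Injective _≡_ _≡_ (f ∘ e) → InducedEmbedding F H (f ∘ e)
  embedding-through embedding f∘e-injective = record
    { injective = f∘e-injective
    ; Adj⇔ = λ i≢j → ⇔.trans (InducedEmbedding.Adj⇔ embedding i≢j)
                               (Adj⇔-separated (i≢j ∘ f∘e-injective))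
    }

  ¬Complete⇒distinctPair : ¬ Complete G → ∃₂ λ x y → x ≢ y
  ¬Complete⇒distinctPair ¬complete =
    let u , v , u≢v , ¬uv = ¬Complete⇒nonadjacentPair G ¬complete
    in f u , f v , λ fu≡fv → ¬uv (from (Adj⇔ u≢v) (inj₁ fu≡fv))

module CriticalCliqueGraph {n m} {G : Graph n} {H : Graph m} {q : Fin n → Fin m}
                           (ccGraph : IsCriticalCliqueGraph G H q) where

  private
    q≡⇔twins : ∀ u v → q u ≡ q v ⇔ TrueTwins G u v
    q≡⇔twins = proj₁ (proj₂ ccGraph)
    AdjH⇔ : ∀ i j → Adj H i j ⇔ (i ≢ j × ∃[ u ] ∃[ v ] (q u ≡ i × q v ≡ j × Adj G u v))
    AdjH⇔ = proj₂ (proj₂ ccGraph)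

  blowUp : IsBlowUp G H q
  blowUp = record { surjective = proj₁ ccGraph ; Adj⇔ = λ u≢v → mk⇔ project (lift u≢v) }
    where
    project : ∀ {u v} → Adj G u v → q u ≡ q v ⊎ Adj H (q u) (q v)
    project {u} {v} uv with q u ≟ q v
    ... | yes qu≡qv = inj₁ qu≡qv
    ... | no qu≢qv = inj₂ (from (AdjH⇔ _ _) (qu≢qv , u , v , refl , refl , uv))
    lift : ∀ {u v} → u ≢ v → q u ≡ q v ⊎ Adj H (q u) (q v) → Adj G u v
    lift {u} {v} u≢v (inj₁ qu≡qv) = twins⇒Adj G (to (q≡⇔twins u v) qu≡qv) u≢v
    lift {u} {v} u≢v (inj₂ quqv) =
      let _ , u′ , v′ , qu′≡qu , qv′≡qv , u′v′ = to (AdjH⇔ _ _) quqv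
      in twins-respect-Adj G (to (q≡⇔twins u u′) (sym qu′≡qu)) (to (q≡⇔twins v v′) (sym qv′≡qv))
                             u≢v u′v′

  open BlowUp blowUp public

  twinFree : TwinFree H
  twinFree i j twins = f∘section-injective (from (q≡⇔twins _ _) (twins-lift twins′))
    where
    twins′ : TrueTwins H (q (section i)) (q (section j))
    twins′ = subst₂ (TrueTwins H) (sym (f∘section i)) (sym (f∘section j)) twins

  diamondFree : StrictlyChordal G → DiamondFree H
  diamondFree (_ , K , blockGraph , f , surjective , Adj⇔) =
    diamondFree-restrict (BlowUp.embedding-through K-blowUp section-embedding toK-injective)
                         (blockGraph⇒DiamondFree K blockGraph)
    where
    K-blowUp : IsBlowUp G K f
    K-blowUp = record { surjective = surjective ; Adj⇔ = Adj⇔ _ _ }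
    toK-injective : Injective _≡_ _≡_ (f ∘ section)
    toK-injective = f∘section-injective ∘ from (q≡⇔twins _ _) ∘ BlowUp.fibre-twins K-blowUp

-- Interval models of diamond-free graphs

module IntervalModel {n} (X : Graph n) (a b : Fin n → ℕ) (a≤b : ∀ v → a v ≤ b v)
                     (Adj⇔overlap : ∀ u v → u ≢ v → Adj X u v ⇔ (a u ≤ b v × a v ≤ b u))
                     (diamondFree : DiamondFree X) where

  overlap⇒Adj : ∀ {u v} → u ≢ v → a u ≤ b v → a v ≤ b u → Adj X u v
  overlap⇒Adj {u} {v} u≢v au≤bv av≤bu = from (Adj⇔overlap u v u≢v) (au≤bv , av≤bu)

  Adj⇒overlap : ∀ {u v} → Adj X u v → a u ≤ b v × a v ≤ b u
  Adj⇒overlap {u} {v} uv = to (Adj⇔overlap u v (Adj⇒≢ X uv)) uv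

  ¬Adj⇒separated : ∀ {u v} → u ≢ v → a u ≤ a v → ¬ Adj X u v → b u < a v
  ¬Adj⇒separated {u} {v} u≢v au≤av ¬uv =
    ≰⇒> λ av≤bu → ¬uv (overlap⇒Adj u≢v (≤-trans au≤av (a≤b v)) av≤bu)

  nested⇒Simplicial : ∀ {u v} → u ≢ v → a v ≤ a u → b u ≤ b v → Simplicial X u
  nested⇒Simplicial {u} {v} u≢v av≤au bu≤bv = dominated⇒Simplicial X diamondFree uv inN[v]
    where
    uv : Adj X u v
    uv = overlap⇒Adj u≢v (≤-trans (a≤b u) bu≤bv) (≤-trans av≤au (a≤b u))
    inN[v] : ∀ {t} → Adj X u t → InN[_] X v t
    inN[v] {t} ut with t ≟ v
    ... | yes t≡v = inj₁ t≡v
    ... | no t≢v = inj₂ (Adj-sym X (overlap⇒Adj t≢v (≤-trans (proj₂ (Adj⇒overlap ut)) bu≤bv)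
                                                    (≤-trans av≤au (proj₁ (Adj⇒overlap ut)))))

  ¬Simplicial-a-injective : ∀ {u v} → ¬ Simplicial X u → ¬ Simplicial X v → a u ≡ a v → u ≡ v
  ¬Simplicial-a-injective {u} {v} ¬su ¬sv au≡av with u ≟ v
  ... | yes u≡v = u≡v
  ... | no u≢v with ≤-total (b u) (b v)
  ...   | inj₁ bu≤bv = contradiction (nested⇒Simplicial u≢v (≤-reflexive (sym au≡av)) bu≤bv) ¬su
  ...   | inj₂ bv≤bu = contradiction (nested⇒Simplicial (≢-sym u≢v) (≤-reflexive au≡av) bv≤bu) ¬sv

  ¬Simplicial-a<⇒b< : ∀ {u v} → ¬ Simplicial X v → a u < a v → b u < b v
  ¬Simplicial-a<⇒b< {u} {v} ¬sv au<av = ≰⇒> λ bv≤bu →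
    ¬sv (nested⇒Simplicial (λ v≡u → <-irrefl (cong a (sym v≡u)) au<av) (<⇒≤ au<av) bv≤bu)

  spanned⇒Simplicial : ∀ {u v w} → a u < a v → a v < a w → b u < b v → b v < b w →
                       Adj X u w → Simplicial X v
  spanned⇒Simplicial {u} {v} {w} au<av av<aw bu<bv bv<bw uw = dominated⇒Simplicial X diamondFree vu inN[u]
    where
    aw≤bu : a w ≤ b u
    aw≤bu = proj₂ (Adj⇒overlap uw)
    vu : Adj X v u
    vu = overlap⇒Adj (λ { refl → <-irrefl refl au<av }) (≤-trans (<⇒≤ av<aw) aw≤bu)
                                                         (≤-trans (<⇒≤ au<av) (a≤b v))
    vw : Adj X v w
    vw = overlap⇒Adj (λ { refl → <-irrefl refl av<aw }) (≤-trans (a≤b v) (<⇒≤ bv<bw))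
                                                         (≤-trans aw≤bu (<⇒≤ bu<bv))
    inN[u] : ∀ {t} → Adj X v t → InN[_] X u t
    inN[u] {t} vt with t ≟ u | a t ≤? b u
    ... | yes t≡u | _ = inj₁ t≡u
    ... | no t≢u | yes at≤bu =
      inj₂ (Adj-sym X (overlap⇒Adj t≢u at≤bu (≤-trans (<⇒≤ au<av) (proj₁ (Adj⇒overlap vt)))))
    ... | no t≢u | no at≰bu with t ≟ w
    ...   | yes refl = inj₂ uw
    ...   | no t≢w = inj₂ (diamondFree vw vu vt (Adj-sym X uw) wt (≢-sym t≢u))
      where
      wt : Adj X w t
      wt = Adj-sym X (overlap⇒Adj t≢w (≤-trans (proj₂ (Adj⇒overlap vt)) (<⇒≤ bv<bw))
                                      (≤-trans aw≤bu (≤-trans (<⇒≤ (≰⇒> at≰bu)) (a≤b t))))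

  successive⇒Adj : Connected X → ∀ {u v} → ¬ Simplicial X u → ¬ Simplicial X v → a u < a v →
                   (∀ {t} → ¬ Simplicial X t → a u < a t → a t < a v → ⊥) → Adj X u v
  successive⇒Adj (_ , conn) {u} {v} ¬su ¬sv au<av nothingBetween = decidable-stable (Adj? X u v) λ ¬uv →
    crossed (¬Adj⇒separated (λ { refl → <-irrefl refl au<av }) (<⇒≤ au<av) ¬uv)
    where
    straddling⇒Simplicial : b u < a v → ∀ {t} → a t ≤ b u → b u < b t → Simplicial X t
    straddling⇒Simplicial bu<av {t} at≤bu bu<bt = decidable-stable (Simplicial? X t) λ ¬st →
      case <-cmp (a t) (a u) of λ where
        (tri< at<au _ _) → <⇒≱ (¬Simplicial-a<⇒b< ¬su at<au) (<⇒≤ bu<bt)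
        (tri≈ _ at≡au _) → case ¬Simplicial-a-injective ¬st ¬su at≡au of λ { refl → <-irrefl refl bu<bt }
        (tri> _ _ au<at) → nothingBetween ¬st au<at (≤-<-trans at≤bu bu<av)
    crossed : b u < a v → ⊥
    crossed bu<av with walk-crossing X a (conn u v ∈⊤ ∈⊤) (a≤b u) bu<av
    ... | z , y , zy , az≤bu , bu<ay = <⇒≱ bu<ay (proj₂ (Adj⇒overlap uy))
      where
      bu<bz : b u < b z
      bu<bz = <-≤-trans bu<ay (proj₂ (Adj⇒overlap zy))
      zu : Adj X z u
      zu = overlap⇒Adj (λ { refl → <-irrefl refl bu<bz }) az≤bu (≤-trans (a≤b u) (<⇒≤ bu<bz))
      uy : Adj X u y
      uy = straddling⇒Simplicial bu<av az≤bu bu<bz u y zu zy λ { refl → <⇒≱ bu<ay (a≤b u) }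

  open IncreasingEnumeration (increasingEnumeration (¬? ∘ Simplicial? X) ¬Simplicial-a-injective)

  b-mono : ∀ {i j} → toℕ i < toℕ j → b (elem i) < b (elem j)
  b-mono {j = j} = ¬Simplicial-a<⇒b< (elem∈P j) ∘ key-strictMono

  successor⇒Adj : Connected X → ∀ {i j} → suc (toℕ i) ≡ toℕ j → Adj X (elem i) (elem j)
  successor⇒Adj conn {i} {j} i+1≡j =
    successive⇒Adj conn (elem∈P i) (elem∈P j) (key-strictMono (≤-reflexive i+1≡j)) nothingBetween
    where
    nothingBetween : ∀ {t} → ¬ Simplicial X t → a (elem i) < a t → a t < a (elem j) → ⊥
    nothingBetween ¬st ai<at at<aj with elem-onto _ ¬st
    ... | l , refl = <⇒≱ (key-reflects-< ai<at) (≤-pred (subst (toℕ l <_) (sym i+1≡j) (key-reflects-< at<aj)))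

  Adj⇒successor : ∀ {i j} → toℕ i < toℕ j → Adj X (elem i) (elem j) → suc (toℕ i) ≡ toℕ j
  Adj⇒successor {i} {j} i<j ij with suc (toℕ i) ≟ℕ toℕ j
  ... | yes i+1≡j = i+1≡j
  ... | no i+1≢j =
    contradiction (spanned⇒Simplicial (key-strictMono i<l) (key-strictMono l<j) (b-mono i<l) (b-mono l<j) ij)
                  (elem∈P l)
    where
    i+1<j : suc (toℕ i) < toℕ j
    i+1<j = ≤∧≢⇒< i<j i+1≢j
    l : Fin size
    l = fromℕ< (<-trans i+1<j (toℕ<n j))
    i<l : toℕ i < toℕ l
    i<l = subst (toℕ i <_) (sym (toℕ-fromℕ< _)) (n<1+n (toℕ i))
    l<j : toℕ l < toℕ j
    l<j = subst (_< toℕ j) (sym (toℕ-fromℕ< _)) i+1<j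

  elem-Adj⇔ : Connected X → ∀ i j → Adj X (elem i) (elem j) ⇔ Consecutive (toℕ i) (toℕ j)
  elem-Adj⇔ conn i j = mk⇔ Adj⇒consecutive consecutive⇒Adj
    where
    Adj⇒consecutive : Adj X (elem i) (elem j) → Consecutive (toℕ i) (toℕ j)
    Adj⇒consecutive ij with <-cmp (toℕ i) (toℕ j)
    ... | tri< i<j _ _ = inj₁ (Adj⇒successor i<j ij)
    ... | tri≈ _ i≡j _ = contradiction (cong elem (toℕ-injective i≡j)) (Adj⇒≢ X ij)
    ... | tri> _ _ j<i = inj₂ (Adj⇒successor j<i (Adj-sym X ij))
    consecutive⇒Adj : Consecutive (toℕ i) (toℕ j) → Adj X (elem i) (elem j)
    consecutive⇒Adj (inj₁ i+1≡j) = successor⇒Adj conn i+1≡j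
    consecutive⇒Adj (inj₂ j+1≡i) = Adj-sym X (successor⇒Adj conn j+1≡i)

  derivedIsPath : Connected X → ∃[ x ] ¬ Simplicial X x → DerivedIsPath X
  derivedIsPath conn (x₀ , ¬sx₀) =
    size , ≤-trans (s≤s z≤n) (toℕ<n (proj₁ (elem-onto x₀ ¬sx₀))) ,
    elem , elem-injective , elem∈P , elem-onto , elem-Adj⇔ conn

interval⇒DerivedIsPath : ∀ {n} (X : Graph n) → DiamondFree X → Connected X → ∃[ x ] ¬ Simplicial X x →
                         Interval X → DerivedIsPath X
interval⇒DerivedIsPath X diamondFree conn ∃¬s (a , b , a≤b , Adj⇔overlap) =
  IntervalModel.derivedIsPath X a b a≤b Adj⇔overlap diamondFree conn ∃¬s

-- Interval models from derived paths

2*-≤⇔ : ∀ {m n} → 2 * m ≤ 2 * n ⇔ m ≤ n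
2*-≤⇔ = mk⇔ (*-cancelˡ-≤ 2) (*-monoʳ-≤ 2)

2*-≤-odd⇔ : ∀ {m n} → 2 * m ≤ suc (2 * n) ⇔ m ≤ n
2*-≤-odd⇔ {m} {n} = mk⇔
  (λ le → ≤-pred (*-cancelˡ-< 2 m (suc n) (≤-<-trans le odd<2*suc)))
  (λ m≤n → m≤n⇒m≤1+n (*-monoʳ-≤ 2 m≤n))
  where
  odd<2*suc : suc (2 * n) < 2 * suc n
  odd<2*suc = subst (suc (2 * n) <_) (sym (*-suc 2 n)) (n<1+n (suc (2 * n)))

odd-≤-2*⇔ : ∀ {m n} → suc (2 * m) ≤ 2 * n ⇔ m < n
odd-≤-2*⇔ {m} {n} = mk⇔ (*-cancelˡ-< 2 m n)
  (λ m<n → ≤-trans (subst (suc (2 * m) ≤_) (sym (*-suc 2 m)) (n≤1+n _)) (*-monoʳ-≤ 2 m<n))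

SpanContains : ℕ → ℕ → Set
SpanContains j t = 2 * j ≤ t × t ≤ 2 * suc j

oddSlot : ∀ {i j} → SpanContains j (suc (2 * i)) ⇔ j ≡ i
oddSlot {i} = mk⇔ (λ (lo , hi) → ≤-antisym (to 2*-≤-odd⇔ lo) (≤-pred (to odd-≤-2*⇔ hi)))
                  (λ { refl → from (2*-≤-odd⇔ {i}) ≤-refl , from (odd-≤-2*⇔ {i}) ≤-refl })

evenSlot : ∀ {i j} → SpanContains j (2 * suc i) ⇔ (i ≤ j × j ≤ suc i)
evenSlot = mk⇔ (λ (lo , hi) → ≤-pred (to 2*-≤⇔ hi) , to 2*-≤⇔ lo)
               (λ (i≤j , j≤i+1) → from 2*-≤⇔ j≤i+1 , from 2*-≤⇔ (s≤s i≤j))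

module DerivedPathModel {m} (X : Graph m) (twinFree : TwinFree X) (conn : Connected X)
                        {k} (k≥1 : 1 ≤ k) (w : Fin k → Fin m) (w-injective : Injective _≡_ _≡_ w)
                        (w-¬simplicial : ∀ i → ¬ Simplicial X (w i))
                        (w-onto : ∀ x → ¬ Simplicial X x → ∃[ i ] w i ≡ x)
                        (w-Adj : ∀ i j → Adj X (w i) (w j) ⇔ Consecutive (toℕ i) (toℕ j)) where

  data Placement (x : Fin m) : Set where
    onPath : (i : Fin k) → w i ≡ x → Placement x
    leaf   : Simplicial X x → (t : ℕ) → (∀ j → Adj X x (w j) ⇔ SpanContains (toℕ j) t) → Placement x

  pathNeighbour : ∀ {x} → Simplicial X x → ∃[ j ] Adj X x (w j)
  pathNeighbour {x} sx =
    let z , xz = walk⇒neighbour X (proj₂ conn x (w (fromℕ< k≥1)) ∈⊤ ∈⊤)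
                                 (λ x≡w₀ → w-¬simplicial _ (subst (Simplicial X) x≡w₀ sx))
        j , wj≡z = w-onto z (λ sz → simplicial-nonadjacent X twinFree sx sz xz)
    in j , subst (Adj X x) (sym wj≡z) xz

  pathNeighbours-close : ∀ {x i j} → Simplicial X x → Adj X x (w i) → Adj X x (w j) →
                         toℕ i ≡ toℕ j ⊎ Consecutive (toℕ i) (toℕ j)
  pathNeighbours-close {i = i} {j} sx xi xj with i ≟ j
  ... | yes refl = inj₁ refl
  ... | no i≢j = inj₂ (to (w-Adj i j) (sx (w i) (w j) xi xj (i≢j ∘ w-injective)))

  leafPlacement : ∀ {x} → Simplicial X x → Placement x
  leafPlacement {x} sx with leastWitness (λ j → Adj? X x (w j)) (pathNeighbour sx)
  ... | lo , x~lo , lo-least = placeBy (any? λ j → (suc (toℕ lo) ≟ℕ toℕ j) ×-dec Adj? X x (w j))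
    where
    near-lo : ∀ {j} → Adj X x (w j) → toℕ j ≡ toℕ lo ⊎ suc (toℕ lo) ≡ toℕ j
    near-lo {j} x~j with pathNeighbours-close sx x~lo x~j
    ... | inj₁ lo≡j = inj₁ (sym lo≡j)
    ... | inj₂ (inj₁ lo+1≡j) = inj₂ lo+1≡j
    ... | inj₂ (inj₂ j+1≡lo) = contradiction (lo-least j x~j) (<⇒≱ (≤-reflexive j+1≡lo))

    placeBy : Dec (∃[ j ] suc (toℕ lo) ≡ toℕ j × Adj X x (w j)) → Placement x
    placeBy (yes (hi , lo+1≡hi , x~hi)) =
      leaf sx (2 * suc (toℕ lo)) λ j → ⇔.trans (mk⇔ bounded (attached j)) (⇔.sym evenSlot)
      where
      bounded : ∀ {j} → Adj X x (w j) → toℕ lo ≤ toℕ j × toℕ j ≤ suc (toℕ lo)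
      bounded {j} x~j with near-lo x~j
      ... | inj₁ j≡lo = lo-least j x~j , m≤n⇒m≤1+n (≤-reflexive j≡lo)
      ... | inj₂ lo+1≡j = lo-least j x~j , ≤-reflexive (sym lo+1≡j)
      attached : ∀ j → toℕ lo ≤ toℕ j × toℕ j ≤ suc (toℕ lo) → Adj X x (w j)
      attached j (lo≤j , j≤lo+1) with m≤n⇒m<n∨m≡n j≤lo+1
      ... | inj₁ j<lo+1 = subst (Adj X x ∘ w) (toℕ-injective (≤-antisym lo≤j (≤-pred j<lo+1))) x~lo
      ... | inj₂ j≡lo+1 = subst (Adj X x ∘ w) (toℕ-injective (trans (sym lo+1≡hi) (sym j≡lo+1))) x~hi
    placeBy (no ¬hi) =
      leaf sx (suc (2 * toℕ lo)) λ j → ⇔.trans (mk⇔ only-lo (attached j)) (⇔.sym oddSlot)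
      where
      only-lo : ∀ {j} → Adj X x (w j) → toℕ j ≡ toℕ lo
      only-lo {j} x~j with near-lo x~j
      ... | inj₁ j≡lo = j≡lo
      ... | inj₂ lo+1≡j = contradiction (j , lo+1≡j , x~j) ¬hi
      attached : ∀ j → toℕ j ≡ toℕ lo → Adj X x (w j)
      attached j j≡lo = subst (Adj X x ∘ w) (toℕ-injective (sym j≡lo)) x~lo

  placement : ∀ x → Placement x
  placement x with Simplicial? X x
  ... | yes sx = leafPlacement sx
  ... | no ¬sx = onPath (proj₁ (w-onto x ¬sx)) (proj₂ (w-onto x ¬sx))

  -- Slot t is the range [t M, t M + m]; leaf x sits at offset toℕ x in it, keeping distinct leaves apart.
  M : ℕ
  M = suc m

  offset<M : ∀ x → toℕ x < M
  offset<M x = m<n⇒m<1+n (toℕ<n x)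

  left right : ∀ {x} → Placement x → ℕ
  left (onPath i _) = 2 * toℕ i * M + 0
  left {x} (leaf _ t _) = t * M + toℕ x
  right (onPath i _) = 2 * suc (toℕ i) * M + m
  right {x} (leaf _ t _) = t * M + toℕ x

  left≤right : ∀ {x} (px : Placement x) → left px ≤ right px
  left≤right (onPath i _) = from (*+-≤⇔ z≤n ≤-refl) (*-monoʳ-≤ 2 (n≤1+n (toℕ i)))
  left≤right (leaf _ _ _) = ≤-refl

  span-overlap⇔ : ∀ i {x} t →
    (2 * i * M + 0 ≤ t * M + toℕ x × t * M + toℕ x ≤ 2 * suc i * M + m) ⇔ SpanContains i t
  span-overlap⇔ i {x} t = *+-≤⇔ z≤n (offset<M x) ×-⇔ *+-≤⇔ (<⇒≤ (toℕ<n x)) ≤-refl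

  Adj⇔overlap : ∀ {x y} → x ≢ y → (px : Placement x) (py : Placement y) →
                Adj X x y ⇔ (left px ≤ right py × left py ≤ right px)
  Adj⇔overlap x≢y (onPath i refl) (onPath j refl) =
    ⇔.trans (w-Adj i j) (⇔.sym (⇔.trans (*+-≤⇔ z≤n ≤-refl ×-⇔ *+-≤⇔ z≤n ≤-refl)
                                 (⇔.trans (2*-≤⇔ ×-⇔ 2*-≤⇔) (consecutive⇔ i≢j))))
    where
    i≢j : toℕ i ≢ toℕ j
    i≢j = x≢y ∘ cong w ∘ toℕ-injective
  Adj⇔overlap x≢y (onPath i refl) (leaf _ t attached) =
    ⇔.trans (mk⇔ (Adj-sym X) (Adj-sym X)) (⇔.trans (attached i) (⇔.sym (span-overlap⇔ (toℕ i) t)))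
  Adj⇔overlap x≢y (leaf _ t attached) (onPath j refl) =
    ⇔.trans (attached j) (⇔.trans (⇔.sym (span-overlap⇔ (toℕ j) t)) (mk⇔ swap swap))
  Adj⇔overlap x≢y (leaf sx t _) (leaf sy t′ _) = mk⇔
    (λ xy → contradiction xy (simplicial-nonadjacent X twinFree sx sy))
    (λ (l≤r , r≤l) → contradiction (toℕ-injective (*+-injectiveʳ {p = t} {q = t′} (offset<M _) (offset<M _)
                                                                  (≤-antisym l≤r r≤l)))
                                    x≢y)

  interval : Interval X
  interval = left ∘ placement , right ∘ placement , left≤right ∘ placement ,
             λ x y x≢y → Adj⇔overlap x≢y (placement x) (placement y)

derivedIsPath⇒Interval : ∀ {m} (X : Graph m) → TwinFree X → Connected X → DerivedIsPath X → Interval X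
derivedIsPath⇒Interval X twinFree conn (_ , k≥1 , w , w-injective , w-¬simplicial , w-onto , w-Adj) =
  DerivedPathModel.interval X twinFree conn k≥1 w w-injective w-¬simplicial w-onto w-Adj

theorem6 : ∀ {n} (G : Graph n) → Connected G → ¬ Complete G → StrictlyChordal G →
    ∀ {m} (H : Graph m) (q : Fin n → Fin m) → IsCriticalCliqueGraph G H q →
    (StrictlyInterval G ⇔ DerivedIsPath H)
theorem6 G connG ¬complete strictlyChordal H q ccGraph = mk⇔ forward backward
  where
  open CriticalCliqueGraph ccGraph
  connH : Connected H
  connH = connected connG
  ∃¬simplicial : ∃[ x ] ¬ Simplicial H x
  ∃¬simplicial = let _ , _ , x≢y = ¬Complete⇒distinctPair ¬complete in ∃¬Simplicial H twinFree connH x≢y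
  forward : StrictlyInterval G → DerivedIsPath H
  forward (_ , intervalG) = interval⇒DerivedIsPath H (diamondFree strictlyChordal) connH ∃¬simplicial
                                                   (interval-restrict section-embedding intervalG)
  backward : DerivedIsPath H → StrictlyInterval G
  backward path = strictlyChordal , interval-lift (derivedIsPath⇒Interval H twinFree connH path)
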